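{- Let $Q$ be a quiver with an automorphism $\tau$ of order $2$. Then the folding of $Q$ whose groups are the orbits of nodes under $\tau$ is valid.
   Context: A quiver is a finite directed graph (multiple arrows allowed) without loops and without oriented 2-cycles. Mutation of $Q$ at node $k$: for every pair of arrows $i\to k$, $k\to j$ add an arrow $i\to j$ and cancel resulting 2-cycles, then reverse every arrow incident to $k$. A folding of $Q$ is a partition of its nodes into non-empty disjoint sets (groups). A group mutation at a group is the successive mutation at every node of the group. A folding is valid if (1) there are no arrows between nodes in the same group, and (2) condition (1) continues to hold after any finite sequence of group mutations at these fixed groups. -}

module Defs where

open import Data.Nat using (ℕ; _+_; _*_; _∸_; _≤ᵇ_)
open import Data.Fin using (Fin; toℕ; _≟_)
open import Data.List using (List; foldl; filter; allFin)
open import Data.Product using (_×_; ∃)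
open import Data.Sum using (_⊎_)
open import Data.Bool using (if_then_else_)
open import Relation.Nullary using (¬_; yes; no)
open import Relation.Binary.PropositionalEquality using (_≡_; _≢_)

-- A quiver on the node set Fin n, given by its arrow counts:
-- arr i j = number of arrows i → j.
ArrowCount : ℕ → Set
ArrowCount n = Fin n → Fin n → ℕ

record Quiver (n : ℕ) : Set where
  constructor mkQuiver
  field
    arr     : ArrowCount n
    noLoop  : ∀ i → arr i i ≡ 0
    no2cyc  : ∀ i j → arr i j ≡ 0 ⊎ arr j i ≡ 0

-- Arrows incident to k are reversed; for i, j ≠ k the arrows i → j are
-- the old ones plus one per path i → k → j, and then 2-cycles with
-- the (analogously enlarged) arrows j → i are cancelled.
mutateArr : ∀ {n} → Fin n → ArrowCount n → ArrowCount n
mutateArr k a i j with i ≟ k | j ≟ k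
... | yes _ | _     = a j i
... | no _  | yes _ = a j i
... | no _  | no _  =
  (a i j + a i k * a k j) ∸ (a j i + a j k * a k i)

-- A folding, given by a labelling of nodes: the groups are the
-- (non-empty) fibres of the labelling.  Two nodes are in the same
-- group iff they have the same label.
Folding : ℕ → Set
Folding n = Fin n → Fin n

groupMutate : ∀ {n} → Folding n → Fin n → ArrowCount n → ArrowCount n
groupMutate {n} g k a =
  foldl (λ b j → mutateArr j b) a (filter (λ j → g j ≟ g k) (allFin n))

groupMutateSeq : ∀ {n} → Folding n → List (Fin n) → ArrowCount n → ArrowCount n
groupMutateSeq g ks a = foldl (λ b k → groupMutate g k b) a ks

NoInnerArrows : ∀ {n} → Folding n → ArrowCount n → Set
NoInnerArrows g a = ∀ i j → g i ≡ g j → a i j ≡ 0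

-- Valid folding: (1) holds, and continues to hold after any finite sequence
-- of group mutations (the empty sequence gives (1) itself).
ValidFolding : ∀ {n} → Quiver n → Folding n → Set
ValidFolding Q g = ∀ ks → NoInnerArrows g (groupMutateSeq g ks (Quiver.arr Q))

IsAutomorphism : ∀ {n} → Quiver n → (Fin n → Fin n) → Set
IsAutomorphism Q τ =
  (∀ x y → τ x ≡ τ y → x ≡ y) × (∀ i j → Quiver.arr Q (τ i) (τ j) ≡ Quiver.arr Q i j)

HasOrder2 : ∀ {n} → (Fin n → Fin n) → Set
HasOrder2 τ = (∀ i → τ (τ i) ≡ i) × ∃ (λ i → τ i ≢ i)

-- The orbit folding: node i is labelled by the smaller of i and τ i,
-- so the groups are exactly the τ-orbits {i, τ i}.
orbitFolding : ∀ {n} → (Fin n → Fin n) → Folding n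
orbitFolding τ i = if toℕ i ≤ᵇ toℕ (τ i) then i else τ i

-- The quiver stays 2-cycle-free and τ-invariant along any sequence of orbit mutations.
-- A τ-fixed node is mutated alone, and mutation is equivariant under relabelling by τ.
-- In a two-element orbit {x, τ x}, τ maps the arrows x → τ x onto those τ x → x, so
-- 2-cycle-freeness leaves none; mutations at unlinked nodes commute, hence μ_{τx} μ_x is
-- again τ-equivariant. Finally, an invariant 2-cycle-free quiver has no arrows inside an orbit.
module Submission where

open import Defs
open import Data.Nat using (ℕ; suc; _+_; _*_; _∸_; _≤ᵇ_)
open import Data.Nat.Properties
  using (≤ᵇ-reflects-≤; ≤-total; m≤n⇒m∸n≡0; ≤-antisym; ≰⇒≥; 0∸n≡0; +-identityʳ; *-zeroʳ; +-commutativeSemigroup)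
open import Algebra.Properties.CommutativeSemigroup +-commutativeSemigroup using (xy∙z≈xz∙y)
open import Data.Fin using (Fin; toℕ; _≟_)
open import Data.Fin.Properties using (toℕ-injective)
open import Data.List using (List; []; _∷_; foldl; filter; allFin)
open import Data.List.Relation.Unary.All using (All; []; _∷_)
import Data.List.Relation.Unary.All as All
open import Data.List.Relation.Unary.All.Properties using (all-filter)
open import Data.List.Relation.Unary.Any using (here)
open import Data.List.Relation.Unary.AllPairs using ([]; _∷_)
open import Data.List.Relation.Unary.Unique.Propositional using (Unique)
import Data.List.Relation.Unary.Unique.Propositional.Properties as Unique
open import Data.List.Membership.Propositional using (_∈_)
open import Data.List.Membership.Propositional.Properties using (∈-filter⁺; ∈-allFin)
open import Data.Product using (_×_; _,_; proj₁; proj₂; swap)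
open import Data.Sum using (_⊎_; inj₁; inj₂) renaming (swap to swap-⊎; map to map-⊎)
open import Data.Bool using (true; false)
open import Data.Empty using (⊥-elim)
open import Function using (_∘_)
open import Relation.Nullary using (yes; no; ofʸ; ofⁿ)
open import Relation.Binary.PropositionalEquality

private variable
  n : ℕ

_≐_ : ArrowCount n → ArrowCount n → Set
a ≐ b = ∀ i j → a i j ≡ b i j

TwoCycleFree : ArrowCount n → Set
TwoCycleFree a = ∀ i j → a i j ≡ 0 ⊎ a j i ≡ 0

Unlinked : ArrowCount n → Fin n → Fin n → Set
Unlinked a k l = a k l ≡ 0 × a l k ≡ 0

relabel : (Fin n → Fin n) → ArrowCount n → ArrowCount n
relabel τ a i j = a (τ i) (τ j)

m≡0⊎n≡0⇒m∸n≡m : ∀ {m n} → m ≡ 0 ⊎ n ≡ 0 → m ∸ n ≡ m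
m≡0⊎n≡0⇒m∸n≡m {n = n} (inj₁ refl) = 0∸n≡0 n
m≡0⊎n≡0⇒m∸n≡m         (inj₂ refl) = refl

[m∸n+o]∸[n∸m+p]≡[m+o]∸[n+p] : ∀ m n o p → (m ∸ n + o) ∸ (n ∸ m + p) ≡ (m + o) ∸ (n + p)
[m∸n+o]∸[n∸m+p]≡[m+o]∸[n+p] 0       0       o p = refl
[m∸n+o]∸[n∸m+p]≡[m+o]∸[n+p] 0       (suc n) o p = refl
[m∸n+o]∸[n∸m+p]≡[m+o]∸[n+p] (suc m) 0       o p = refl
[m∸n+o]∸[n∸m+p]≡[m+o]∸[n+p] (suc m) (suc n) o p = [m∸n+o]∸[n∸m+p]≡[m+o]∸[n+p] m n o p

Incident : Fin n → Fin n → Fin n → Set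
Incident k i j = i ≡ k ⊎ j ≡ k

incident? : (k i j : Fin n) → Incident k i j ⊎ (i ≢ k × j ≢ k)
incident? k i j with i ≟ k | j ≟ k
... | yes i≡k | _       = inj₁ (inj₁ i≡k)
... | no _    | yes j≡k = inj₁ (inj₂ j≡k)
... | no i≢k  | no j≢k  = inj₂ (i≢k , j≢k)

module _ (k : Fin n) {a : ArrowCount n} where

  mutateArr-incident : ∀ {i j} → Incident k i j → mutateArr k a i j ≡ a j i
  mutateArr-incident {i} {j} inc with i ≟ k | j ≟ k | inc
  ... | yes _  | _      | _        = refl
  ... | no _   | yes _  | _        = refl
  ... | no i≢k | no _   | inj₁ i≡k = ⊥-elim (i≢k i≡k)
  ... | no _   | no j≢k | inj₂ j≡k = ⊥-elim (j≢k j≡k)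

  mutateArr-away : ∀ {i j} → i ≢ k → j ≢ k →
    mutateArr k a i j ≡ (a i j + a i k * a k j) ∸ (a j i + a j k * a k i)
  mutateArr-away {i} {j} i≢k j≢k with i ≟ k | j ≟ k
  ... | yes i≡k | _       = ⊥-elim (i≢k i≡k)
  ... | no _    | yes j≡k = ⊥-elim (j≢k j≡k)
  ... | no _    | no _    = refl

TwoCycleFree⇒loopFree : {a : ArrowCount n} → TwoCycleFree a → ∀ i → a i i ≡ 0
TwoCycleFree⇒loopFree tcf i with tcf i i
... | inj₁ aii≡0 = aii≡0
... | inj₂ aii≡0 = aii≡0

m∸n≡0⊎n∸m≡0 : ∀ m n → m ∸ n ≡ 0 ⊎ n ∸ m ≡ 0
m∸n≡0⊎n∸m≡0 m n with ≤-total m n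
... | inj₁ m≤n = inj₁ (m≤n⇒m∸n≡0 m≤n)
... | inj₂ n≤m = inj₂ (m≤n⇒m∸n≡0 n≤m)

mutateArr-twoCycleFree : ∀ {a : ArrowCount n} k → TwoCycleFree a → TwoCycleFree (mutateArr k a)
mutateArr-twoCycleFree {a = a} k tcf i j with incident? k i j
... | inj₁ inc rewrite mutateArr-incident k {a} inc | mutateArr-incident k {a} (swap-⊎ inc) = tcf j i
... | inj₂ (i≢k , j≢k) rewrite mutateArr-away k {a} i≢k j≢k | mutateArr-away k {a} j≢k i≢k =
  m∸n≡0⊎n∸m≡0 (a i j + a i k * a k j) (a j i + a j k * a k i)

mutateArr-cong : ∀ {a b : ArrowCount n} k → a ≐ b → mutateArr k a ≐ mutateArr k b
mutateArr-cong {a = a} {b} k a≐b i j with incident? k i j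
... | inj₁ inc = trans (mutateArr-incident k inc) (trans (a≐b j i) (sym (mutateArr-incident k inc)))
... | inj₂ (i≢k , j≢k) = begin
  mutateArr k a i j                                 ≡⟨ mutateArr-away k i≢k j≢k ⟩
  (a i j + a i k * a k j) ∸ (a j i + a j k * a k i) ≡⟨ cong₂ _∸_
      (cong₂ _+_ (a≐b i j) (cong₂ _*_ (a≐b i k) (a≐b k j)))
      (cong₂ _+_ (a≐b j i) (cong₂ _*_ (a≐b j k) (a≐b k i))) ⟩
  (b i j + b i k * b k j) ∸ (b j i + b j k * b k i) ≡⟨ mutateArr-away k i≢k j≢k ⟨
  mutateArr k b i j                                 ∎
  where open ≡-Reasoning

relabel-mutateArr : ∀ {τ : Fin n → Fin n} → (∀ {x y} → τ x ≡ τ y → x ≡ y) →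
  ∀ k a → relabel τ (mutateArr (τ k) a) ≐ mutateArr k (relabel τ a)
relabel-mutateArr {τ = τ} τ-injective k a i j with incident? k i j
... | inj₁ inc = trans (mutateArr-incident (τ k) (map-⊎ (cong τ) (cong τ) inc)) (sym (mutateArr-incident k inc))
... | inj₂ (i≢k , j≢k) =
  trans (mutateArr-away (τ k) (i≢k ∘ τ-injective) (j≢k ∘ τ-injective)) (sym (mutateArr-away k i≢k j≢k))

mutateArr-unlinked : ∀ {a : ArrowCount n} {k l} → Unlinked a k l → Unlinked (mutateArr k a) k l
mutateArr-unlinked {a = a} {k} {l} (akl≡0 , alk≡0) =
  trans (mutateArr-incident k (inj₁ refl)) alk≡0 , trans (mutateArr-incident k {a} {l} (inj₂ refl)) akl≡0

module _ {a : ArrowCount n} (tcf : TwoCycleFree a) {k : Fin n} where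

  mutateArr-pathless : ∀ {i j} → i ≢ k → j ≢ k → a i k * a k j ≡ 0 → a j k * a k i ≡ 0 →
    mutateArr k a i j ≡ a i j
  mutateArr-pathless {i} {j} i≢k j≢k no-path-ij no-path-ji = begin
    mutateArr k a i j                                 ≡⟨ mutateArr-away k i≢k j≢k ⟩
    (a i j + a i k * a k j) ∸ (a j i + a j k * a k i) ≡⟨ cong₂ (λ p q → (a i j + p) ∸ (a j i + q)) no-path-ij no-path-ji ⟩
    (a i j + 0) ∸ (a j i + 0)                         ≡⟨ cong₂ _∸_ (+-identityʳ (a i j)) (+-identityʳ (a j i)) ⟩
    a i j ∸ a j i                                     ≡⟨ m≡0⊎n≡0⇒m∸n≡m (tcf i j) ⟩
    a i j                                             ∎
    where open ≡-Reasoning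

  module _ {x : Fin n} (x≢k : x ≢ k) (xk : Unlinked a x k) where

    private
      axk≡0 : a x k ≡ 0
      axk≡0 = proj₁ xk

      akx≡0 : a k x ≡ 0
      akx≡0 = proj₂ xk

    mutateArr-unlinked-row : ∀ j → mutateArr k a x j ≡ a x j
    mutateArr-unlinked-row j with incident? k x j
    ... | inj₁ (inj₁ x≡k)  = ⊥-elim (x≢k x≡k)
    ... | inj₁ (inj₂ refl) = trans (mutateArr-incident k {a} {x} (inj₂ refl)) (trans akx≡0 (sym axk≡0))
    ... | inj₂ (_ , j≢k)   = mutateArr-pathless x≢k j≢k
      (cong (_* a k j) axk≡0) (trans (cong (a j k *_) akx≡0) (*-zeroʳ (a j k)))

    mutateArr-unlinked-column : ∀ j → mutateArr k a j x ≡ a j x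
    mutateArr-unlinked-column j with incident? k j x
    ... | inj₁ (inj₂ x≡k)  = ⊥-elim (x≢k x≡k)
    ... | inj₁ (inj₁ refl) = trans (mutateArr-incident k (inj₁ refl)) (trans axk≡0 (sym akx≡0))
    ... | inj₂ (j≢k , _)   = mutateArr-pathless j≢k x≢k
      (trans (cong (a j k *_) akx≡0) (*-zeroʳ (a j k))) (cong (_* a k j) axk≡0)

module _ {a : ArrowCount n} (tcf : TwoCycleFree a) {k l : Fin n} (k≢l : k ≢ l) (kl : Unlinked a k l) where

  private
    tcf′ : TwoCycleFree (mutateArr k a)
    tcf′ = mutateArr-twoCycleFree k tcf

    kl′ : Unlinked (mutateArr k a) k l
    kl′ = mutateArr-unlinked {a = a} kl

  mutateArr-comm-source : ∀ j → mutateArr k (mutateArr l a) k j ≡ mutateArr l (mutateArr k a) k j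
  mutateArr-comm-source j = begin
    mutateArr k (mutateArr l a) k j ≡⟨ mutateArr-incident k (inj₁ refl) ⟩
    mutateArr l a j k               ≡⟨ mutateArr-unlinked-column tcf k≢l kl j ⟩
    a j k                           ≡⟨ mutateArr-incident k (inj₁ refl) ⟨
    mutateArr k a k j               ≡⟨ mutateArr-unlinked-row tcf′ k≢l kl′ j ⟨
    mutateArr l (mutateArr k a) k j ∎
    where open ≡-Reasoning

  mutateArr-comm-target : ∀ i → mutateArr k (mutateArr l a) i k ≡ mutateArr l (mutateArr k a) i k
  mutateArr-comm-target i = begin
    mutateArr k (mutateArr l a) i k ≡⟨ mutateArr-incident k {i = i} (inj₂ refl) ⟩
    mutateArr l a k i               ≡⟨ mutateArr-unlinked-row tcf k≢l kl i ⟩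
    a k i                           ≡⟨ mutateArr-incident k {i = i} (inj₂ refl) ⟨
    mutateArr k a i k               ≡⟨ mutateArr-unlinked-column tcf′ k≢l kl′ i ⟨
    mutateArr l (mutateArr k a) i k ∎
    where open ≡-Reasoning

  -- μ_l leaves every arrow at k unchanged, so its 2-cycle cancellation can be postponed past μ_k.
  mutateArr-twice-away : ∀ {i j} → i ≢ k → i ≢ l → j ≢ k → j ≢ l →
    mutateArr k (mutateArr l a) i j ≡
      (a i j + a i l * a l j + a i k * a k j) ∸ (a j i + a j l * a l i + a j k * a k i)
  mutateArr-twice-away {i} {j} i≢k i≢l j≢k j≢l = begin
    mutateArr k b i j                                         ≡⟨ mutateArr-away k i≢k j≢k ⟩
    (b i j + b i k * b k j) ∸ (b j i + b j k * b k i)         ≡⟨ cong₂ (λ p q → (b i j + p) ∸ (b j i + q))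
                                                                   (cong₂ _*_ (column i) (row j))
                                                                   (cong₂ _*_ (column j) (row i)) ⟩
    (b i j + a i k * a k j) ∸ (b j i + a j k * a k i)         ≡⟨ cong₂ (λ p q → (p + a i k * a k j) ∸ (q + a j k * a k i))
                                                                   (mutateArr-away l i≢l j≢l)
                                                                   (mutateArr-away l j≢l i≢l) ⟩
    (p ∸ q + a i k * a k j) ∸ (q ∸ p + a j k * a k i)         ≡⟨ [m∸n+o]∸[n∸m+p]≡[m+o]∸[n+p] p q _ _ ⟩
    (p + a i k * a k j) ∸ (q + a j k * a k i)                 ∎
    where
    open ≡-Reasoning
    b = mutateArr l a
    p = a i j + a i l * a l j
    q = a j i + a j l * a l i
    row = mutateArr-unlinked-row tcf k≢l kl
    column = mutateArr-unlinked-column tcf k≢l kl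

endpoint? : (k l i : Fin n) → i ≡ k ⊎ i ≡ l ⊎ (i ≢ k × i ≢ l)
endpoint? k l i with i ≟ k | i ≟ l
... | yes i≡k | _       = inj₁ i≡k
... | no _    | yes i≡l = inj₂ (inj₁ i≡l)
... | no i≢k  | no i≢l  = inj₂ (inj₂ (i≢k , i≢l))

mutateArr-comm : ∀ {a : ArrowCount n} {k l} → TwoCycleFree a → k ≢ l → Unlinked a k l →
  mutateArr k (mutateArr l a) ≐ mutateArr l (mutateArr k a)
mutateArr-comm {a = a} {k} {l} tcf k≢l kl i j with endpoint? k l i | endpoint? k l j
... | inj₁ refl        | _                = mutateArr-comm-source tcf k≢l kl j
... | inj₂ (inj₁ refl) | _                = sym (mutateArr-comm-source tcf (k≢l ∘ sym) (swap kl) j)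
... | inj₂ (inj₂ _)    | inj₁ refl        = mutateArr-comm-target tcf k≢l kl i
... | inj₂ (inj₂ _)    | inj₂ (inj₁ refl) = sym (mutateArr-comm-target tcf (k≢l ∘ sym) (swap kl) i)
... | inj₂ (inj₂ (i≢k , i≢l)) | inj₂ (inj₂ (j≢k , j≢l)) = begin
  mutateArr k (mutateArr l a) i j
    ≡⟨ mutateArr-twice-away tcf k≢l kl i≢k i≢l j≢k j≢l ⟩
  (a i j + a i l * a l j + a i k * a k j) ∸ (a j i + a j l * a l i + a j k * a k i)
    ≡⟨ cong₂ _∸_ (xy∙z≈xz∙y (a i j) _ _) (xy∙z≈xz∙y (a j i) _ _) ⟩
  (a i j + a i k * a k j + a i l * a l j) ∸ (a j i + a j k * a k i + a j l * a l i)
    ≡⟨ mutateArr-twice-away tcf (k≢l ∘ sym) (swap kl) i≢l i≢k j≢l j≢k ⟨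
  mutateArr l (mutateArr k a) i j
    ∎
  where open ≡-Reasoning

orbitFolding-choice : (τ : Fin n → Fin n) → ∀ i → orbitFolding τ i ≡ i ⊎ orbitFolding τ i ≡ τ i
orbitFolding-choice τ i with toℕ i ≤ᵇ toℕ (τ i)
... | true  = inj₁ refl
... | false = inj₂ refl

module Orbits {τ : Fin n → Fin n} (τ-involutive : ∀ i → τ (τ i) ≡ i) where

  τ-injective : ∀ {x y} → τ x ≡ τ y → x ≡ y
  τ-injective {x} {y} τx≡τy = trans (sym (τ-involutive x)) (trans (cong τ τx≡τy) (τ-involutive y))

  InOrbit : Fin n → Fin n → Set
  InOrbit k j = j ≡ k ⊎ j ≡ τ k

  inOrbit-other : ∀ {k u v} → InOrbit k u → InOrbit k v → u ≢ v → v ≡ τ u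
  inOrbit-other (inj₁ refl) (inj₁ refl) u≢v = ⊥-elim (u≢v refl)
  inOrbit-other (inj₁ refl) (inj₂ refl) _ = refl
  inOrbit-other {k} (inj₂ refl) (inj₁ refl) _ = sym (τ-involutive k)
  inOrbit-other (inj₂ refl) (inj₂ refl) u≢v = ⊥-elim (u≢v refl)

  orbitFolding-τ : ∀ k → orbitFolding τ (τ k) ≡ orbitFolding τ k
  orbitFolding-τ k rewrite τ-involutive k
    with toℕ k ≤ᵇ toℕ (τ k) | ≤ᵇ-reflects-≤ (toℕ k) (toℕ (τ k))
       | toℕ (τ k) ≤ᵇ toℕ k | ≤ᵇ-reflects-≤ (toℕ (τ k)) (toℕ k)
  ... | true  | ofʸ k≤τk  | true  | ofʸ τk≤k  = toℕ-injective (≤-antisym τk≤k k≤τk)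
  ... | true  | _         | false | _         = refl
  ... | false | _         | true  | _         = refl
  ... | false | ofⁿ k≰τk  | false | ofⁿ τk≰k  = ⊥-elim (τk≰k (≰⇒≥ k≰τk))

  orbitFolding-fibre : ∀ {j k} → orbitFolding τ j ≡ orbitFolding τ k → InOrbit k j
  orbitFolding-fibre {j} {k} gj≡gk with orbitFolding-choice τ j | orbitFolding-choice τ k
  ... | inj₁ gj≡j  | inj₁ gk≡k  = inj₁ (trans (sym gj≡j) (trans gj≡gk gk≡k))
  ... | inj₁ gj≡j  | inj₂ gk≡τk = inj₂ (trans (sym gj≡j) (trans gj≡gk gk≡τk))
  ... | inj₂ gj≡τj | inj₁ gk≡k  =
    inj₂ (trans (sym (τ-involutive j)) (cong τ (trans (sym gj≡τj) (trans gj≡gk gk≡k))))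
  ... | inj₂ gj≡τj | inj₂ gk≡τk = inj₁ (τ-injective (trans (sym gj≡τj) (trans gj≡gk gk≡τk)))

  data OrbitEnumeration : List (Fin n) → Set where
    fixedPoint : ∀ {x} → τ x ≡ x → OrbitEnumeration (x ∷ [])
    pair       : ∀ {x} → x ≢ τ x → OrbitEnumeration (x ∷ τ x ∷ [])

  orbitEnumeration : ∀ {k ys} → Unique ys → All (InOrbit k) ys → k ∈ ys → τ k ∈ ys →
    OrbitEnumeration ys
  orbitEnumeration _ [] () _
  orbitEnumeration _ (_ ∷ []) (here k≡x) (here τk≡x) = fixedPoint (trans (cong τ (sym k≡x)) τk≡x)
  orbitEnumeration ((x≢y ∷ []) ∷ _) (x∈ ∷ y∈ ∷ []) _ _ with inOrbit-other x∈ y∈ x≢y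
  ... | refl = pair x≢y
  orbitEnumeration ((x≢y ∷ x≢z ∷ _) ∷ (y≢z ∷ _) ∷ _) (x∈ ∷ y∈ ∷ z∈ ∷ _) _ _ =
    ⊥-elim (y≢z (trans (inOrbit-other x∈ y∈ x≢y) (sym (inOrbit-other x∈ z∈ x≢z))))

  group-orbitEnumeration : ∀ k → OrbitEnumeration (filter (λ j → orbitFolding τ j ≟ orbitFolding τ k) (allFin n))
  group-orbitEnumeration k = orbitEnumeration
    (Unique.filter⁺ sameGroup? (Unique.allFin⁺ n))
    (All.map orbitFolding-fibre (all-filter sameGroup? (allFin n)))
    (∈-filter⁺ sameGroup? (∈-allFin k) refl)
    (∈-filter⁺ sameGroup? (∈-allFin (τ k)) (orbitFolding-τ k))
    where sameGroup? = λ j → orbitFolding τ j ≟ orbitFolding τ k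

  Invariant : ArrowCount n → Set
  Invariant a = relabel τ a ≐ a

  Admissible : ArrowCount n → Set
  Admissible a = TwoCycleFree a × Invariant a

  invariant-orbit-reversal : ∀ {a} → Invariant a → ∀ x → a x (τ x) ≡ a (τ x) x
  invariant-orbit-reversal {a} inv x = trans (sym (inv x (τ x))) (cong (a (τ x)) (τ-involutive x))

  orbit-unlinked : ∀ {a} → Admissible a → ∀ x → Unlinked a x (τ x)
  orbit-unlinked (tcf , inv) x with tcf x (τ x) | invariant-orbit-reversal inv x
  ... | inj₁ forward≡0  | reversal = forward≡0 , trans (sym reversal) forward≡0
  ... | inj₂ backward≡0 | reversal = trans reversal backward≡0 , backward≡0

  relabel-mutateArr-invariant : ∀ {a} → Invariant a → ∀ k → relabel τ (mutateArr k a) ≐ mutateArr (τ k) a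
  relabel-mutateArr-invariant {a} inv k i j =
    trans (cong (λ y → mutateArr y a (τ i) (τ j)) (sym (τ-involutive k)))
          (trans (relabel-mutateArr τ-injective (τ k) a i j) (mutateArr-cong (τ k) inv i j))

  mutateArr-fixedPoint-invariant : ∀ {a x} → Invariant a → τ x ≡ x → Invariant (mutateArr x a)
  mutateArr-fixedPoint-invariant {a} {x} inv τx≡x i j =
    trans (relabel-mutateArr-invariant inv x i j) (cong (λ y → mutateArr y a i j) τx≡x)

  mutateArr-pair-invariant : ∀ {a x} → Admissible a → x ≢ τ x → Invariant (mutateArr (τ x) (mutateArr x a))
  mutateArr-pair-invariant {a} {x} adm@(tcf , inv) x≢τx i j =
    trans (relabel-mutateArr τ-injective x (mutateArr x a) i j)
      (trans (mutateArr-cong x (relabel-mutateArr-invariant inv x) i j)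
             (mutateArr-comm tcf x≢τx (orbit-unlinked adm x) i j))

  mutateOrbit-admissible : ∀ {a ys} → Admissible a → OrbitEnumeration ys →
    Admissible (foldl (λ b j → mutateArr j b) a ys)
  mutateOrbit-admissible (tcf , inv) (fixedPoint {x} τx≡x) =
    mutateArr-twoCycleFree x tcf , mutateArr-fixedPoint-invariant inv τx≡x
  mutateOrbit-admissible adm@(tcf , _) (pair {x} x≢τx) =
    mutateArr-twoCycleFree (τ x) (mutateArr-twoCycleFree x tcf) , mutateArr-pair-invariant adm x≢τx

  groupMutateSeq-admissible : ∀ ks {a} → Admissible a → Admissible (groupMutateSeq (orbitFolding τ) ks a)
  groupMutateSeq-admissible []       adm = adm
  groupMutateSeq-admissible (k ∷ ks) adm =
    groupMutateSeq-admissible ks (mutateOrbit-admissible adm (group-orbitEnumeration k))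

  admissible⇒noInnerArrows : ∀ {a} → Admissible a → NoInnerArrows (orbitFolding τ) a
  admissible⇒noInnerArrows adm@(tcf , _) i j gi≡gj with orbitFolding-fibre {i} {j} gi≡gj
  ... | inj₁ refl = TwoCycleFree⇒loopFree tcf i
  ... | inj₂ refl = proj₂ (orbit-unlinked adm j)

mainTheorem2 : (n : ℕ) (Q : Quiver n) (τ : Fin n → Fin n) →
    IsAutomorphism Q τ → HasOrder2 τ → ValidFolding Q (orbitFolding τ)
mainTheorem2 n Q τ (_ , τ-preserves-arrows) (τ-involutive , _) ks =
  admissible⇒noInnerArrows (groupMutateSeq-admissible ks (Quiver.no2cyc Q , τ-preserves-arrows))
  where open Orbits {τ = τ} τ-involutive
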